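{- Let $H$ be a bipartite graph with no vertex of degree zero or one. There is a bijection between the set $\mathcal{C}(H)$ of maximal cliques of $G(H)$ with respect to the canonical bipartite framing and the set $\mathcal{M}(H)$ of matchings of the almost-degree-whiskered graph $W(H)$.
   Context: Let $H$ have vertex set $S\uplus T$ with $S=\{1,\dots,n\}$, $T=\{n+1,\dots,n+m\}$, every edge joining $S$ to $T$. The extension $G(H)$ is obtained from $H$ (edges directed from $S$ to $T$) by adding vertices $s,t$, two parallel edges $\alpha_{1,i},\alpha_{2,i}$ from $s$ to each $i\in S$, an edge $\beta_{i,j}$ from $i$ to $j$ for each edge $ij$ of $H$, and two parallel edges $\gamma_{j,1},\gamma_{j,2}$ from each $j\in T$ to $t$. Routes are directed $s$–$t$ paths, all of the form $\alpha_{a,i}\beta_{i,j}\gamma_{j,b}$. The canonical bipartite framing orders edges at each inner vertex by $\alpha_{1,i}<\alpha_{2,i}$, $\gamma_{j,1}<\gamma_{j,2}$, $\beta_{i,j}<\beta_{i,k}$ if $j<k$, $\beta_{j,i}<\beta_{k,i}$ if $j<k$. With respect to it, two routes are incoherent exactly when they are of one of the forms: $\alpha_{1,i}\beta_{i,j}\gamma_{j,2}$ and $\alpha_{2,i}\beta_{i,j}\gamma_{j,1}$; $\alpha_{1,i}\beta_{i,k}\gamma_{k,b}$ and $\alpha_{2,i}\beta_{i,j}\gamma_{j,b'}$ with $j<k$; $\alpha_{a,i}\beta_{i,j}\gamma_{j,2}$ and $\alpha_{a',i'}\beta_{i',j}\gamma_{j,1}$ with $i<i'$. A clique is a set of pairwise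 coherent routes; $\mathcal{C}(H)$ is the set of inclusion-maximal cliques. $W(H)$ is obtained from $H$ by attaching $\deg_H(v)-1$ new pendant vertices to each vertex $v$. -}

module Defs where

open import Level using (0ℓ)
open import Data.Bool using (Bool; true; false; T)
open import Data.Nat using (ℕ; zero; suc; _+_; _∸_; _≤_)
open import Data.Fin using (Fin; zero; suc; _<_)
open import Data.Product using (Σ; _×_; _,_; proj₁; proj₂)
open import Data.Sum using (_⊎_; inj₁; inj₂)
open import Relation.Nullary using (¬_)
open import Relation.Binary.Bundles using (Setoid)
open import Relation.Binary.PropositionalEquality using (_≡_; refl; sym; trans)

-- Bipartite graphs H with S = Fin n (vertices 1..n, in this order) and
-- T = Fin m (vertices n+1..n+m, in this order).

record BipGraph : Set where
  field
    n   : ℕ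
    m   : ℕ
    adj : Fin n → Fin m → Bool

count : ∀ {r} → (Fin r → Bool) → ℕ
count {zero}  p = 0
count {suc r} p with p zero
... | true  = suc (count (λ k → p (suc k)))
... | false = count (λ k → p (suc k))

module _ (H : BipGraph) where
  open BipGraph H

  HV : Set
  HV = Fin n ⊎ Fin m

  deg : HV → ℕ
  deg (inj₁ i) = count (λ j → adj i j)
  deg (inj₂ j) = count (λ i → adj i j)

  NoDeg01 : Set
  NoDeg01 = (v : HV) → 2 ≤ deg v

  -- Routes of G(H):  α_{a,i} β_{i,j} γ_{j,b}, with a, b ∈ Fin 2
  -- (zero ↦ index 1, suc zero ↦ index 2) and ij an edge of H.

  record Route : Set where
    constructor route
    field
      a   : Fin 2
      i   : Fin n
      j   : Fin m
      b   : Fin 2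
      edg : T (adj i j)

  one two : Fin 2
  one = zero
  two = suc zero

  -- The (ordered) incoherence forms w.r.t. the canonical bipartite framing.
  data IncoherentForm : Route → Route → Set where
    form1 : ∀ {i j} (e e' : T (adj i j)) →
            IncoherentForm (route one i j two e) (route two i j one e')
    form2 : ∀ {i j k b b'} (e : T (adj i k)) (e' : T (adj i j)) → j < k →
            IncoherentForm (route one i k b e) (route two i j b' e')
    form3 : ∀ {a a' i i' j} (e : T (adj i j)) (e' : T (adj i' j)) → i < i' →
            IncoherentForm (route a i j two e) (route a' i' j one e')

  Incoherent : Route → Route → Set
  Incoherent r r' = IncoherentForm r r' ⊎ IncoherentForm r' r

  Coherent : Route → Route → Set
  Coherent r r' = ¬ Incoherent r r'

  RouteSet : Set
  RouteSet = Route → Bool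

  IsClique : RouteSet → Set
  IsClique C = ∀ r r' → T (C r) → T (C r') → Coherent r r'

  _⊆R_ : RouteSet → RouteSet → Set
  C ⊆R D = ∀ r → T (C r) → T (D r)

  IsMaximalClique : RouteSet → Set
  IsMaximalClique C = IsClique C × (∀ D → IsClique D → C ⊆R D → D ⊆R C)

  MaxCliques : Setoid 0ℓ 0ℓ
  MaxCliques = record
    { Carrier       = Σ RouteSet IsMaximalClique
    ; _≈_           = λ C D → ∀ r → proj₁ C r ≡ proj₁ D r
    ; isEquivalence = record
      { refl  = λ r → refl
      ; sym   = λ p r → sym (p r)
      ; trans = λ p q r → trans (p r) (q r)
      }
    }

record Graph : Set₁ where
  field
    Vertex : Set
    Edge   : Set
    ends   : Edge → Vertex × Vertex

module _ (G : Graph) where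
  open Graph G

  Incident : Vertex → Edge → Set
  Incident x e = (x ≡ proj₁ (ends e)) ⊎ (x ≡ proj₂ (ends e))

  IsMatching : (Edge → Bool) → Set
  IsMatching M = ∀ e e' → T (M e) → T (M e') →
                 ∀ x → Incident x e → Incident x e' → e ≡ e'

  Matchings : Setoid 0ℓ 0ℓ
  Matchings = record
    { Carrier       = Σ (Edge → Bool) IsMatching
    ; _≈_           = λ M N → ∀ e → proj₁ M e ≡ proj₁ N e
    ; isEquivalence = record
      { refl  = λ e → refl
      ; sym   = λ p e → sym (p e)
      ; trans = λ p q e → trans (p e) (q e)
      }
    }

module _ (H : BipGraph) where
  open BipGraph H

  data WVertex : Set where
    orig : HV H → WVertex
    pend : (v : HV H) → Fin (deg H v ∸ 1) → WVertex

  data WEdge : Set where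
    hedge : (i : Fin n) (j : Fin m) → T (adj i j) → WEdge
    wedge : (v : HV H) → Fin (deg H v ∸ 1) → WEdge

  wends : WEdge → WVertex × WVertex
  wends (hedge i j _) = orig (inj₁ i) , orig (inj₂ j)
  wends (wedge v k)   = orig v , pend v k

  W : Graph
  W = record { Vertex = WVertex ; Edge = WEdge ; ends = wends }

-- A maximal clique C of G(H) is determined by the following data.  Every vertex v of H of positive
-- degree has a pivot: the unique neighbour p such that C has routes through the edge vp with both
-- α-indices (v ∈ S), resp. both γ-indices (v ∈ T).  Uniqueness is incoherence of form 2 (form 3);
-- existence is maximality: the pivot of i ∈ S is the least neighbour used with α₂, or, if there is
-- none, the greatest neighbour used with α₁.  The routes of C through ij are then exactly those whose
-- α-index fits the position of j relative to the pivot of i (α₁ at or below it, α₂ at or above it)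
-- and whose γ-index fits the position of i relative to the pivot of j, except that when i and j are
-- each other's pivots only one of the incoherent routes α₁βγ₂, α₂βγ₁ is present.
-- A matching of W(H) encodes the same data: the H-edge ij is matched iff i and j are mutual pivots
-- carrying α₁βγ₂; a vertex not matched along H has as pivot its (k+1)-st neighbour if its k-th
-- whisker is matched, and its first neighbour if it is unmatched.

module Submission where

open import Defs hiding (one; two)
open import Data.Bool using (Bool; true; false; T; not; _∧_; _∨_; if_then_else_)
open import Data.Bool.Properties using (T-irrelevant; T-≡; T-∧; T-∨; ∧-inverseʳ; ∧-identityʳ; if-cong; if-cong₂)
open import Data.Empty using (⊥; ⊥-elim)
open import Data.Fin using (Fin; zero; suc; toℕ; _<_; _≤_)
open import Data.Fin.Properties using (any?; _<?_; _≟_; <-cmp; <-trans; ≤-antisym; suc-injective; 0≢1+n)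
open import Data.Nat as ℕ using (ℕ; _∸_; s≤s)
import Data.Nat.Properties as ℕₚ
open import Data.Product using (∃; _×_; _,_; proj₁; proj₂; map₂)
open import Data.Sum using (_⊎_; inj₁; inj₂; [_,_])
open import Relation.Binary.Definitions using (tri<; tri≈; tri>)
open import Function using (_∘_; Equivalence; Inverse; Congruent; StrictlyInverseˡ; StrictlyInverseʳ)
open import Function.Properties.Inverse using (Inverse⇒Bijection)
import Function.Construct.Composition as Compose
import Function.Consequences.Setoid as Consequences
open import Level using (0ℓ)
open import Relation.Binary.Bundles using (Setoid)
open import Function.Bundles using (Bijection)
open import Relation.Nullary using (¬_; Dec; yes; no)
open import Relation.Nullary.Decidable
  using (isYes; isNo; _×-dec_; T?; toWitness; fromWitness; toWitnessFalse; fromWitnessFalse; decidable-stable)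
open import Relation.Binary.PropositionalEquality
  using (_≡_; _≢_; refl; sym; trans; cong; cong₂; subst; module ≡-Reasoning)

pattern one = zero
pattern two = suc zero

T-ext : ∀ {x y} → (T x → T y) → (T y → T x) → x ≡ y
T-ext {false} {false} _ _ = refl
T-ext {false} {true}  _ g = ⊥-elim (g _)
T-ext {true}  {false} f _ = ⊥-elim (f _)
T-ext {true}  {true}  _ _ = refl

¬T⇒≡false : ∀ {x} → ¬ T x → x ≡ false
¬T⇒≡false {false} _ = refl
¬T⇒≡false {true}  h = ⊥-elim (h _)

T-not⁻ : ∀ {x} → T (not x) → ¬ T x
T-not⁻ {true} ()

module _ {x y : Bool} where

  ∧⁻ : T (x ∧ y) → T x × T y
  ∧⁻ = Equivalence.to T-∧

  ∧⁺ : T x → T y → T (x ∧ y)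
  ∧⁺ p q = Equivalence.from T-∧ (p , q)

  ∨⁻ : T (x ∨ y) → T x ⊎ T y
  ∨⁻ = Equivalence.to T-∨

  ∨⁺ : T x ⊎ T y → T (x ∨ y)
  ∨⁺ = Equivalence.from T-∨

whenT : ∀ {b} → (T b → Bool) → Bool
whenT {true}  f = f _
whenT {false} _ = false

whenT-≡ : ∀ {b} (f : T b → Bool) (p : T b) → whenT f ≡ f p
whenT-≡ {true} _ _ = refl

whenT-T : ∀ {b} (f : T b → Bool) → T (whenT f) → T b
whenT-T {true} _ _ = _

whenT-const : ∀ {b c} (f : T b → Bool) → (∀ p → f p ≡ c) → (T c → T b) → whenT f ≡ c
whenT-const {true}          f eq _  = eq _
whenT-const {false} {false} _ _  _  = refl
whenT-const {false} {true}  _ _  cb = ⊥-elim (cb _)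

whenT-cong : ∀ {b} {f g : T b → Bool} → (∀ p → f p ≡ g p) → whenT f ≡ whenT g
whenT-cong {true}  eq = eq _
whenT-cong {false} _  = refl

AtMostOne : {A : Set} → (A → Bool) → Set
AtMostOne P = ∀ {x y} → T (P x) → T (P y) → x ≡ y

anyᵇ : ∀ {r} → (Fin r → Bool) → Bool
anyᵇ P = isYes (any? (T? ∘ P))

module _ {r} {P : Fin r → Bool} where

  any-intro : ∀ x → T (P x) → T (anyᵇ P)
  any-intro x p = fromWitness (x , p)

  any-elim : T (anyᵇ P) → ∃ λ x → T (P x)
  any-elim = toWitness

  none-intro : (∀ x → ¬ T (P x)) → T (not (anyᵇ P))
  none-intro h = fromWitnessFalse λ (x , p) → h x p

  none-elim : T (not (anyᵇ P)) → ∀ x → ¬ T (P x)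
  none-elim h x p = toWitnessFalse h (x , p)

isYes-cong : ∀ {A B : Set} {a? : Dec A} {b? : Dec B} → (A → B) → (B → A) → isYes a? ≡ isYes b?
isYes-cong f g = T-ext (fromWitness ∘ f ∘ toWitness) (fromWitness ∘ g ∘ toWitness)

anyᵇ-cong : ∀ {r} {P Q : Fin r → Bool} → (∀ x → P x ≡ Q x) → anyᵇ P ≡ anyᵇ Q
anyᵇ-cong eq = isYes-cong (map₂ (subst T (eq _))) (map₂ (subst T (sym (eq _))))

least : ∀ {r} (P : Fin r → Bool) {x} → T (P x) →
        ∃ λ k → T (P k) × (∀ {y} → y < k → ¬ T (P y))
least P {zero} p = zero , p , λ ()
least P {suc x} p with T? (P zero)
... | yes p₀ = zero , p₀ , λ ()
... | no ¬p₀ with least (P ∘ suc) p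
...   | k , pk , below = suc k , pk , λ { {zero} _ → ¬p₀ ; {suc y} (s≤s y<k) → below y<k }

greatest : ∀ {r} (P : Fin r → Bool) {x} → T (P x) →
           ∃ λ k → T (P k) × (∀ {y} → k < y → ¬ T (P y))
greatest {ℕ.suc r} P {x} p with T? (anyᵇ (P ∘ suc))
greatest {ℕ.suc r} P {x} p | yes later with greatest (P ∘ suc) (proj₂ (any-elim later))
... | k , pk , above = suc k , pk , λ { {suc y} (s≤s k<y) → above k<y }
greatest {ℕ.suc r} P {zero}  p | no ¬later = zero , p , λ { {suc y} _ py → ¬later (any-intro y py) }
greatest {ℕ.suc r} P {suc x} p | no ¬later = ⊥-elim (¬later (any-intro x p))

nth : ∀ {r} (P : Fin r → Bool) → Fin (count P) → Fin r
nth {ℕ.suc r} P c with P zero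
nth {ℕ.suc r} P zero    | true  = zero
nth {ℕ.suc r} P (suc c) | true  = suc (nth (P ∘ suc) c)
nth {ℕ.suc r} P c       | false = suc (nth (P ∘ suc) c)

nth-T : ∀ {r} (P : Fin r → Bool) c → T (P (nth P c))
nth-T {ℕ.suc r} P c with P zero in P₀
nth-T {ℕ.suc r} P zero    | true  = subst T (sym P₀) _
nth-T {ℕ.suc r} P (suc c) | true  = nth-T (P ∘ suc) c
nth-T {ℕ.suc r} P c       | false = nth-T (P ∘ suc) c

rank : ∀ {r} (P : Fin r → Bool) x → T (P x) → Fin (count P)
rank P zero    p with P zero
... | true = zero
rank P (suc x) p with P zero
... | true  = suc (rank (P ∘ suc) x p)
... | false = rank (P ∘ suc) x p

nth-rank : ∀ {r} (P : Fin r → Bool) x (p : T (P x)) → nth P (rank P x p) ≡ x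
nth-rank P zero    p with P zero
... | true = refl
nth-rank P (suc x) p with P zero
... | true  = cong suc (nth-rank (P ∘ suc) x p)
... | false = cong suc (nth-rank (P ∘ suc) x p)

nth-injective : ∀ {r} (P : Fin r → Bool) {c d} → nth P c ≡ nth P d → c ≡ d
nth-injective {ℕ.suc r} P {c} {d} eq with P zero
nth-injective {ℕ.suc r} P {zero}  {zero}  eq | true  = refl
nth-injective {ℕ.suc r} P {suc c} {suc d} eq | true  = cong suc (nth-injective (P ∘ suc) (suc-injective eq))
nth-injective {ℕ.suc r} P {c}     {d}     eq | false = nth-injective (P ∘ suc) (suc-injective eq)

rank-nth : ∀ {r} (P : Fin r → Bool) c (p : T (P (nth P c))) → rank P (nth P c) p ≡ c
rank-nth P c p = nth-injective P (nth-rank P (nth P c) p)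

-- Of the `N` slots of a vertex of degree `N`, slot `zero` stands for the absence of a whisker
-- and slot `lift k` for the whisker `k`.
lift : ∀ {N} → Fin (N ∸ 1) → Fin N
lift {ℕ.suc N} k = suc k

lift-injective : ∀ {N} {k l : Fin (N ∸ 1)} → lift {N} k ≡ lift l → k ≡ l
lift-injective {ℕ.suc N} = suc-injective

slotTaken : ∀ {N} → (Fin (N ∸ 1) → Bool) → Fin N → Bool
slotTaken {ℕ.suc N} w zero    = not (anyᵇ w)
slotTaken {ℕ.suc N} w (suc k) = w k

slotTaken-lift : ∀ {N} (w : Fin (N ∸ 1) → Bool) k → slotTaken {N} w (lift k) ≡ w k
slotTaken-lift {ℕ.suc N} w k = refl

slotTaken-cong : ∀ {N} {w w′ : Fin (N ∸ 1) → Bool} → (∀ k → w k ≡ w′ k) →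
                 ∀ c → slotTaken {N} w c ≡ slotTaken w′ c
slotTaken-cong {ℕ.suc N} eq zero    = cong not (anyᵇ-cong eq)
slotTaken-cong {ℕ.suc N} eq (suc k) = eq k

slotTaken-unique : ∀ {N} {w : Fin (N ∸ 1) → Bool} → AtMostOne w → AtMostOne (slotTaken {N} w)
slotTaken-unique {ℕ.suc N} u {zero}  {zero}  _  _  = refl
slotTaken-unique {ℕ.suc N} u {zero}  {suc l} s₀ wl = ⊥-elim (none-elim s₀ l wl)
slotTaken-unique {ℕ.suc N} u {suc k} {zero}  wk s₀ = ⊥-elim (none-elim s₀ k wk)
slotTaken-unique {ℕ.suc N} u {suc k} {suc l} wk wl = cong suc (u wk wl)

slotTaken-exists : ∀ {N} (w : Fin (N ∸ 1) → Bool) → Fin N → ∃ λ c → T (slotTaken {N} w c)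
slotTaken-exists {ℕ.suc N} w _ with T? (anyᵇ w)
... | yes some = let (k , wk) = any-elim some in suc k , wk
... | no ¬some = zero , none-intro λ k wk → ¬some (any-intro k wk)

slotTaken-restrict : ∀ {N} {Q : Fin N → Bool} → AtMostOne Q → ∀ {c₀} → T (Q c₀) →
                     ∀ c → slotTaken {N} (Q ∘ lift) c ≡ Q c
slotTaken-restrict {ℕ.suc N} u {zero} q₀ zero =
  T-ext (λ _ → q₀) (λ q → none-intro λ k qk → 0≢1+n (u q qk))
slotTaken-restrict {ℕ.suc N} u {suc k₀} q₀ zero =
  T-ext (λ none → ⊥-elim (none-elim none k₀ q₀)) (λ q → ⊥-elim (0≢1+n (u q q₀)))
slotTaken-restrict {ℕ.suc N} u q₀ (suc k) = refl

record IsSelection {r} (nbr sel : Fin r → Bool) : Set where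
  field
    sel⇒nbr  : ∀ {x} → T (sel x) → T (nbr x)
    unique   : AtMostOne sel
    nonempty : ∀ {x} → T (nbr x) → ∃ λ p → T (sel p)

module _ {r} (P : Fin r → Bool) where

  atOrBelow atOrAbove : Fin r → Bool
  atOrBelow x = isNo (any? λ y → y <? x ×-dec T? (P y))
  atOrAbove x = isNo (any? λ y → x <? y ×-dec T? (P y))

-- Form 2 (form 3) puts the α₁-routes (γ₁-routes) at a vertex at or below its pivot and the
-- α₂-routes (γ₂-routes) at or above it.
side : ∀ {r} → Fin 2 → (Fin r → Bool) → Fin r → Bool
side one = atOrBelow
side two = atOrAbove

module _ {r} {P : Fin r → Bool} where

  ¬atOrBelow : ∀ {x} → ¬ T (atOrBelow P x) → ∃ λ y → y < x × T (P y)
  ¬atOrBelow {x} h =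
    decidable-stable (any? λ y → y <? x ×-dec T? (P y)) λ none → h (fromWitnessFalse none)

  ¬atOrAbove : ∀ {x} → ¬ T (atOrAbove P x) → ∃ λ y → x < y × T (P y)
  ¬atOrAbove {x} h =
    decidable-stable (any? λ y → x <? y ×-dec T? (P y)) λ none → h (fromWitnessFalse none)

  module _ (unique : AtMostOne P) {p} (pivot : T (P p)) where

    atOrBelow⇒≤ : ∀ {x} → T (atOrBelow P x) → x ≤ p
    atOrBelow⇒≤ h = ℕₚ.≮⇒≥ λ p<x → toWitnessFalse h (p , p<x , pivot)

    atOrAbove⇒≥ : ∀ {x} → T (atOrAbove P x) → p ≤ x
    atOrAbove⇒≥ h = ℕₚ.≮⇒≥ λ x<p → toWitnessFalse h (p , x<p , pivot)

    ≤⇒atOrBelow : ∀ {x} → x ≤ p → T (atOrBelow P x)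
    ≤⇒atOrBelow x≤p = fromWitnessFalse λ (y , y<x , py) →
      ℕₚ.<⇒≱ y<x (subst (_ ≤_) (sym (unique py pivot)) x≤p)

    ≥⇒atOrAbove : ∀ {x} → p ≤ x → T (atOrAbove P x)
    ≥⇒atOrAbove p≤x = fromWitnessFalse λ (y , x<y , py) →
      ℕₚ.<⇒≱ x<y (subst (_≤ _) (sym (unique py pivot)) p≤x)

    sides⇒selected : ∀ {x} → T (atOrBelow P x) → T (atOrAbove P x) → T (P x)
    sides⇒selected below above =
      subst (T ∘ P) (≤-antisym (atOrAbove⇒≥ above) (atOrBelow⇒≤ below)) pivot

    atOrBelow-or-atOrAbove : ∀ x → T (atOrBelow P x) ⊎ T (atOrAbove P x)
    atOrBelow-or-atOrAbove x with ℕₚ.≤-total (toℕ x) (toℕ p)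
    ... | inj₁ x≤p = inj₁ (≤⇒atOrBelow x≤p)
    ... | inj₂ p≤x = inj₂ (≥⇒atOrAbove p≤x)

    atOrAbove-atOrBelow : ∀ {y z} → T (atOrAbove P y) → T (atOrBelow P z) → ¬ y < z
    atOrAbove-atOrBelow above below y<z =
      ℕₚ.<⇒≱ y<z (ℕₚ.≤-trans (atOrBelow⇒≤ below) (atOrAbove⇒≥ above))

  module _ (unique : AtMostOne P) {x} (px : T (P x)) where

    selected⇒atOrBelow : T (atOrBelow P x)
    selected⇒atOrBelow = ≤⇒atOrBelow unique px ℕₚ.≤-refl

    selected⇒atOrAbove : T (atOrAbove P x)
    selected⇒atOrAbove = ≥⇒atOrAbove unique px ℕₚ.≤-refl

    selected⇒side : ∀ a → T (side a P x)
    selected⇒side one = selected⇒atOrBelow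
    selected⇒side two = selected⇒atOrAbove

side-cong : ∀ {r} {P Q : Fin r → Bool} → (∀ x → P x ≡ Q x) → ∀ a x → side a P x ≡ side a Q x
side-cong eq one x = cong not (isYes-cong (map₂ (map₂ (subst T (eq _)))) (map₂ (map₂ (subst T (sym (eq _))))))
side-cong eq two x = cong not (isYes-cong (map₂ (map₂ (subst T (eq _)))) (map₂ (map₂ (subst T (sym (eq _))))))

-- Encoding a pivot by whiskers

module WhiskerCode {r} (nbr : Fin r → Bool) where

  Whisker : Set
  Whisker = Fin (count nbr ∸ 1)

  record IsLocalMatching (E : Fin r → Bool) (w : Whisker → Bool) : Set where
    field
      edge⇒nbr       : ∀ {x} → T (E x) → T (nbr x)
      edge-unique    : AtMostOne E
      whisker-unique : AtMostOne w
      edge-whisker   : ∀ {x k} → T (E x) → ¬ T (w k)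

  decodePivot : (E : Fin r → Bool) → (Whisker → Bool) → Fin r → Bool
  decodePivot E w x = if anyᵇ E then E x else whenT (λ p → slotTaken w (rank nbr x p))

  encodeWhiskers : (P E : Fin r → Bool) → Whisker → Bool
  encodeWhiskers P E k = P y ∧ not (E y)
    where y = nth nbr (lift k)

  IsLocalMatching-resp : ∀ {E E′ w w′} → (∀ x → E x ≡ E′ x) → (∀ k → w k ≡ w′ k) →
                         IsLocalMatching E w → IsLocalMatching E′ w′
  IsLocalMatching-resp eqE eqw L = record
    { edge⇒nbr       = edge⇒nbr ∘ E⇐
    ; edge-unique    = λ ex ey → edge-unique (E⇐ ex) (E⇐ ey)
    ; whisker-unique = λ wk wl → whisker-unique (w⇐ wk) (w⇐ wl)
    ; edge-whisker   = λ ex wk → edge-whisker (E⇐ ex) (w⇐ wk)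
    }
    where
    open IsLocalMatching L
    E⇐ = λ {x} → subst T (sym (eqE x))
    w⇐ = λ {k} → subst T (sym (eqw k))

  encodeWhiskers-cong : ∀ {P P′ E E′} → (∀ x → P x ≡ P′ x) → (∀ x → E x ≡ E′ x) →
                        ∀ k → encodeWhiskers P E k ≡ encodeWhiskers P′ E′ k
  encodeWhiskers-cong eqP eqE k = cong₂ (λ a b → a ∧ not b) (eqP _) (eqE _)

  module _ {E : Fin r → Bool} {w : Whisker → Bool} where

    decodePivot-covered : T (anyᵇ E) → ∀ x → decodePivot E w x ≡ E x
    decodePivot-covered c x = if-cong (Equivalence.to T-≡ c)

    decodePivot-uncovered : ¬ T (anyᵇ E) → ∀ {x} (p : T (nbr x)) →
                            decodePivot E w x ≡ slotTaken w (rank nbr x p)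
    decodePivot-uncovered u p = trans (if-cong (¬T⇒≡false u)) (whenT-≡ _ p)

    decodePivot-cong : ∀ {E′ w′} → (∀ x → E x ≡ E′ x) → (∀ k → w k ≡ w′ k) →
                       ∀ x → decodePivot E w x ≡ decodePivot E′ w′ x
    decodePivot-cong eqE eqw x =
      trans (if-cong (anyᵇ-cong eqE))
            (if-cong₂ _ (eqE x) (whenT-cong λ p → slotTaken-cong {count nbr} eqw (rank nbr x p)))

    module _ (M : IsLocalMatching E w) where
      open IsLocalMatching M

      edge⇒decodePivot : ∀ {x} → T (E x) → T (decodePivot E w x)
      edge⇒decodePivot {x} ex = subst T (sym (decodePivot-covered (any-intro x ex) x)) ex

      decodePivot-isSelection : IsSelection nbr (decodePivot E w)
      decodePivot-isSelection with T? (anyᵇ E)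
      ... | yes c = record
        { sel⇒nbr  = λ {x} h → edge⇒nbr (subst T (decodePivot-covered c x) h)
        ; unique   = λ {x} {y} hx hy →
                       edge-unique (subst T (decodePivot-covered c x) hx) (subst T (decodePivot-covered c y) hy)
        ; nonempty = λ _ → let (y , ey) = any-elim c in y , edge⇒decodePivot ey
        }
      ... | no u = record
        { sel⇒nbr  = λ h → whenT-T _ (subst T (if-cong (¬T⇒≡false u)) h)
        ; unique   = λ hx hy → slot-unique (taken hx) (taken hy)
        ; nonempty = λ {x} p → let (c , hc) = slotTaken-exists w (rank nbr x p) in
                       nth nbr c , subst T (sym (trans (decodePivot-uncovered u (nth-T nbr c))
                                                       (cong (slotTaken w) (rank-nth nbr c _)))) hc
        }
        where
        taken : ∀ {x} → T (decodePivot E w x) → ∃ λ p → T (slotTaken w (rank nbr x p))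
        taken h = let p = whenT-T _ (subst T (if-cong (¬T⇒≡false u)) h) in
                  p , subst T (decodePivot-uncovered u p) h
        slot-unique : ∀ {x y} → (∃ λ p → T (slotTaken w (rank nbr x p))) →
                      (∃ λ q → T (slotTaken w (rank nbr y q))) → x ≡ y
        slot-unique (p , hp) (q , hq) =
          trans (sym (nth-rank nbr _ p))
                (trans (cong (nth nbr) (slotTaken-unique whisker-unique hp hq)) (nth-rank nbr _ q))

      encode-decode : ∀ k → encodeWhiskers (decodePivot E w) E k ≡ w k
      encode-decode k with T? (anyᵇ E)
      ... | yes c = begin
          decodePivot E w y ∧ not (E y) ≡⟨ cong (_∧ not (E y)) (decodePivot-covered c y) ⟩
          E y ∧ not (E y)               ≡⟨ ∧-inverseʳ (E y) ⟩
          false                         ≡⟨ sym (¬T⇒≡false (edge-whisker (proj₂ (any-elim c)))) ⟩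
          w k                           ∎
        where
        open ≡-Reasoning
        y = nth nbr (lift k)
      ... | no u = begin
          decodePivot E w y ∧ not (E y)
            ≡⟨ cong₂ (λ a b → a ∧ not b) (decodePivot-uncovered u (nth-T nbr _))
                     (¬T⇒≡false λ ey → u (any-intro y ey)) ⟩
          slotTaken w (rank nbr y _) ∧ true      ≡⟨ ∧-identityʳ _ ⟩
          slotTaken w (rank nbr y _)             ≡⟨ cong (slotTaken w) (rank-nth nbr _ _) ⟩
          slotTaken {count nbr} w (lift k)       ≡⟨ slotTaken-lift {count nbr} w k ⟩
          w k                                    ∎
        where
        open ≡-Reasoning
        y = nth nbr (lift k)

  module _ {P E : Fin r → Bool} (S : IsSelection nbr P) (E⇒P : ∀ {x} → T (E x) → T (P x)) where
    open IsSelection S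

    encodeWhiskers-isLocalMatching : IsLocalMatching E (encodeWhiskers P E)
    encodeWhiskers-isLocalMatching = record
      { edge⇒nbr       = sel⇒nbr ∘ E⇒P
      ; edge-unique    = λ ex ey → unique (E⇒P ex) (E⇒P ey)
      ; whisker-unique = λ wk wl →
                           lift-injective (nth-injective nbr (unique (proj₁ (∧⁻ wk)) (proj₁ (∧⁻ wl))))
      ; edge-whisker   = λ ex wk → let (py , ¬ey) = ∧⁻ wk in
                           T-not⁻ ¬ey (subst (T ∘ E) (unique (E⇒P ex) py) ex)
      }

    decode-encode : ∀ x → decodePivot E (encodeWhiskers P E) x ≡ P x
    decode-encode x with T? (anyᵇ E)
    ... | yes c = trans (decodePivot-covered c x) (T-ext E⇒P λ px →
                    let (y , ey) = any-elim c in subst (T ∘ E) (unique (E⇒P ey) px) ey)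
    ... | no u = trans (if-cong (¬T⇒≡false u)) (whenT-const _ restrict sel⇒nbr)
      where
      noEdge : ∀ y → E y ≡ false
      noEdge y = ¬T⇒≡false λ ey → u (any-intro y ey)
      Q : Fin (count nbr) → Bool
      Q c = P (nth nbr c)
      whiskers≗Q : ∀ k → encodeWhiskers P E k ≡ Q (lift k)
      whiskers≗Q k = trans (cong (λ b → Q (lift k) ∧ not b) (noEdge _)) (∧-identityʳ _)
      restrict : (p : T (nbr x)) → slotTaken (encodeWhiskers P E) (rank nbr x p) ≡ P x
      restrict p =
        let (y , py) = nonempty p in
        trans (slotTaken-cong {count nbr} whiskers≗Q (rank nbr x p))
              (trans (slotTaken-restrict {count nbr} (λ qc qd → nth-injective nbr (unique qc qd))
                                         {rank nbr y (sel⇒nbr py)}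
                                         (subst (T ∘ P) (sym (nth-rank nbr y _)) py) (rank nbr x p))
                     (cong P (nth-rank nbr x p)))

-- The routes α_a β_ij γ_b of a clique built from pivots: `A a` (`B b`) says that α_a (γ_b) fits the
-- position of j (i) relative to the pivot of i (j), and `J` chooses between the incoherent routes
-- α₁βγ₂ and α₂βγ₁ when both fit.
cell : (A B : Fin 2 → Bool) (J : Bool) → Fin 2 → Fin 2 → Bool
cell A B J one one = A one ∧ B one
cell A B J one two = A one ∧ B two ∧ (not (A two ∧ B one) ∨ J)
cell A B J two one = A two ∧ B one ∧ (not (A one ∧ B two) ∨ not J)
cell A B J two two = A two ∧ B two

module _ {A B : Fin 2 → Bool} where

  cell⇒sides : ∀ {J} a b → T (cell A B J a b) → T (A a) × T (B b)
  cell⇒sides one one c with A one | B one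
  ... | true  | true  = _ , _
  ... | false | _     = ⊥-elim c
  ... | true  | false = ⊥-elim c
  cell⇒sides one two c with A one | B two
  ... | true  | true  = _ , _
  ... | false | _     = ⊥-elim c
  ... | true  | false = ⊥-elim c
  cell⇒sides two one c with A two | B one
  ... | true  | true  = _ , _
  ... | false | _     = ⊥-elim c
  ... | true  | false = ⊥-elim c
  cell⇒sides two two c with A two | B two
  ... | true  | true  = _ , _
  ... | false | _     = ⊥-elim c
  ... | true  | false = ⊥-elim c

  cell-diag : ∀ {J} a → T (A a) → T (B a) → T (cell A B J a a)
  cell-diag one a b with A one | B one
  ... | true  | true  = _
  ... | false | _     = a
  ... | true  | false = b
  cell-diag two a b with A two | B two
  ... | true  | true  = _
  ... | false | _     = a
  ... | true  | false = b

  cell₁₂-intro : ∀ {J} → T (A one) → T (B two) → (T (A two) → T (B one) → T J) →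
                 T (cell A B J one two)
  cell₁₂-intro {J} a₁ b₂ j with A one | A two | B one | B two | J
  ... | false | _     | _     | _     | _     = ⊥-elim a₁
  ... | true  | _     | _     | false | _     = ⊥-elim b₂
  ... | true  | false | _     | true  | _     = _
  ... | true  | true  | false | true  | _     = _
  ... | true  | true  | true  | true  | true  = _
  ... | true  | true  | true  | true  | false = j _ _

  cell₂₁-intro : ∀ {J} → T (A two) → T (B one) → (T (A one) → T (B two) → ¬ T J) →
                 T (cell A B J two one)
  cell₂₁-intro {J} a₂ b₁ ¬j with A one | A two | B one | B two | J
  ... | _     | false | _     | _     | _     = ⊥-elim a₂
  ... | _     | true  | false | _     | _     = ⊥-elim b₁
  ... | false | true  | true  | _     | _     = _
  ... | true  | true  | true  | false | _     = _
  ... | true  | true  | true  | true  | false = _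
  ... | true  | true  | true  | true  | true  = ⊥-elim (¬j _ _ _)

  cell₁₂⇒J : ∀ {J} → T (A two) → T (B one) → T (cell A B J one two) → T J
  cell₁₂⇒J {J} a₂ b₁ c with A one | A two | B one | B two | J
  ... | _     | _     | _     | _     | true  = _
  ... | false | _     | _     | _     | false = c
  ... | true  | _     | _     | false | false = c
  ... | true  | false | _     | true  | false = a₂
  ... | true  | true  | false | true  | false = b₁
  ... | true  | true  | true  | true  | false = c

  cell-cross : ∀ {J} → T (cell A B J one two) → ¬ T (cell A B J two one)
  cell-cross {J} c₁₂ c₂₁ with A one | A two | B one | B two | J
  ... | false | _     | _     | _     | _     = c₁₂
  ... | true  | _     | _     | false | _     = c₁₂
  ... | true  | false | _     | true  | _     = c₂₁
  ... | true  | true  | false | true  | _     = c₂₁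
  ... | true  | true  | true  | true  | true  = c₂₁
  ... | true  | true  | true  | true  | false = c₁₂

  cell-row : ∀ {J} a → T (A a) → T (B one) ⊎ T (B two) → ∃ λ b → T (cell A B J a b)
  cell-row {J} one a₁ (inj₁ b₁) = one , cell-diag {J} one a₁ b₁
  cell-row {J} one a₁ (inj₂ b₂) with T? (B one)
  ... | yes b₁ = one , cell-diag {J} one a₁ b₁
  ... | no ¬b₁ = two , cell₁₂-intro a₁ b₂ λ _ b₁ → ⊥-elim (¬b₁ b₁)
  cell-row {J} two a₂ (inj₂ b₂) = two , cell-diag {J} two a₂ b₂
  cell-row {J} two a₂ (inj₁ b₁) with T? (B two)
  ... | yes b₂ = two , cell-diag {J} two a₂ b₂
  ... | no ¬b₂ = one , cell₂₁-intro a₂ b₁ λ _ b₂ → ⊥-elim (¬b₂ b₂)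

  cell-col : ∀ {J} b → T (B b) → T (A one) ⊎ T (A two) → ∃ λ a → T (cell A B J a b)
  cell-col {J} one b₁ (inj₁ a₁) = one , cell-diag {J} one a₁ b₁
  cell-col {J} one b₁ (inj₂ a₂) with T? (A one)
  ... | yes a₁ = one , cell-diag {J} one a₁ b₁
  ... | no ¬a₁ = two , cell₂₁-intro a₂ b₁ λ a₁ _ → ⊥-elim (¬a₁ a₁)
  cell-col {J} two b₂ (inj₂ a₂) = two , cell-diag {J} two a₂ b₂
  cell-col {J} two b₂ (inj₁ a₁) with T? (A two)
  ... | yes a₂ = two , cell-diag {J} two a₂ b₂
  ... | no ¬a₂ = one , cell₁₂-intro a₁ b₂ λ a₂ _ → ⊥-elim (¬a₂ a₂)

  cell-complete : ∀ {J} a b → T (A a) → T (B b) → ¬ T (cell A B J a b) → T (cell A B J b a)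
  cell-complete {J} one one a₁ b₁ ¬c = ⊥-elim (¬c (cell-diag {J} one a₁ b₁))
  cell-complete {J} two two a₂ b₂ ¬c = ⊥-elim (¬c (cell-diag {J} two a₂ b₂))
  cell-complete {J} one two a₁ b₂ ¬c with T? J
  ... | yes j = ⊥-elim (¬c (cell₁₂-intro a₁ b₂ λ _ _ → j))
  ... | no ¬j = cell₂₁-intro (sides .proj₁) (sides .proj₂) λ _ _ → ¬j
    where
    sides : T (A two) × T (B one)
    sides with T? (A two) | T? (B one)
    ... | yes a₂ | yes b₁ = a₂ , b₁
    ... | no ¬a₂ | _      = ⊥-elim (¬c (cell₁₂-intro a₁ b₂ λ a₂ _ → ⊥-elim (¬a₂ a₂)))
    ... | yes _  | no ¬b₁ = ⊥-elim (¬c (cell₁₂-intro a₁ b₂ λ _ b₁ → ⊥-elim (¬b₁ b₁)))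
  cell-complete {J} two one a₂ b₁ ¬c with T? J
  ... | no ¬j = ⊥-elim (¬c (cell₂₁-intro a₂ b₁ λ _ _ → ¬j))
  ... | yes j = cell₁₂-intro (sides .proj₁) (sides .proj₂) λ _ _ → j
    where
    sides : T (A one) × T (B two)
    sides with T? (A one) | T? (B two)
    ... | yes a₁ | yes b₂ = a₁ , b₂
    ... | no ¬a₁ | _      = ⊥-elim (¬c (cell₂₁-intro a₂ b₁ λ a₁ _ → ⊥-elim (¬a₁ a₁)))
    ... | yes _  | no ¬b₂ = ⊥-elim (¬c (cell₂₁-intro a₂ b₁ λ _ b₂ → ⊥-elim (¬b₂ b₂)))

cell-cong : ∀ {A A′ B B′ : Fin 2 → Bool} {J J′} → (∀ a → A a ≡ A′ a) → (∀ b → B b ≡ B′ b) →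
            J ≡ J′ → ∀ a b → cell A B J a b ≡ cell A′ B′ J′ a b
cell-cong eA eB refl one one rewrite eA one | eB one = refl
cell-cong eA eB refl one two rewrite eA one | eA two | eB one | eB two = refl
cell-cong eA eB refl two one rewrite eA one | eA two | eB one | eB two = refl
cell-cong eA eB refl two two rewrite eA two | eB two = refl

module _ {S R : Setoid 0ℓ 0ℓ} where
  open Setoid S using () renaming (Carrier to A; _≈_ to _≈₁_)
  open Setoid R using () renaming (Carrier to B; _≈_ to _≈₂_)
  open Consequences S R

  inverseFromStrict : (to : A → B) (from : B → A) → Congruent _≈₁_ _≈₂_ to → Congruent _≈₂_ _≈₁_ from →
                      StrictlyInverseˡ _≈₂_ to from → StrictlyInverseʳ _≈₁_ to from → Inverse S R
  inverseFromStrict to from to-cong from-cong toFrom fromTo = record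
    { to        = to
    ; from      = from
    ; to-cong   = to-cong
    ; from-cong = from-cong
    ; inverse   = strictlyInverseˡ⇒inverseˡ to-cong toFrom , strictlyInverseʳ⇒inverseʳ from-cong fromTo
    }

-- Pivot systems and matchings of W(H)

module _ (H : BipGraph) where
  open BipGraph H
  open WhiskerCode using (IsLocalMatching; decodePivot; encodeWhiskers)
  open IsLocalMatching using (edge-unique; whisker-unique; edge-whisker)

  arity : HV H → ℕ
  arity (inj₁ _) = m
  arity (inj₂ _) = n

  nbrs : (v : HV H) → Fin (arity v) → Bool
  nbrs (inj₁ i) j = adj i j
  nbrs (inj₂ j) i = adj i j

  record PivotSystem : Set where
    field
      pivot             : (v : HV H) → Fin (arity v) → Bool
      joined            : Fin n → Fin m → Bool
      pivot-isSelection : ∀ v → IsSelection (nbrs v) (pivot v)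
      joined⇒pivotˢ     : ∀ {i j} → T (joined i j) → T (pivot (inj₁ i) j)
      joined⇒pivotᵗ     : ∀ {i j} → T (joined i j) → T (pivot (inj₂ j) i)

    joinedAt : (v : HV H) → Fin (arity v) → Bool
    joinedAt (inj₁ i) j = joined i j
    joinedAt (inj₂ j) i = joined i j

    joinedAt⇒pivot : ∀ v {x} → T (joinedAt v x) → T (pivot v x)
    joinedAt⇒pivot (inj₁ _) = joined⇒pivotˢ
    joinedAt⇒pivot (inj₂ _) = joined⇒pivotᵗ

  open PivotSystem

  _≈ᵖ_ : PivotSystem → PivotSystem → Set
  d ≈ᵖ d′ = (∀ v x → pivot d v x ≡ pivot d′ v x) × (∀ i j → joined d i j ≡ joined d′ i j)

  PivotSystems : Setoid 0ℓ 0ℓ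
  PivotSystems = record
    { Carrier       = PivotSystem
    ; _≈_           = _≈ᵖ_
    ; isEquivalence = record
      { refl  = (λ _ _ → refl) , (λ _ _ → refl)
      ; sym   = λ (p , q) → (λ v x → sym (p v x)) , (λ i j → sym (q i j))
      ; trans = λ (p , q) (p′ , q′) → (λ v x → trans (p v x) (p′ v x)) , (λ i j → trans (q i j) (q′ i j))
      }
    }

  hasEdge : (WEdge H → Bool) → Fin n → Fin m → Bool
  hasEdge M i j = whenT (λ e → M (hedge i j e))

  edgesAt : (WEdge H → Bool) → (v : HV H) → Fin (arity v) → Bool
  edgesAt M (inj₁ i) j = hasEdge M i j
  edgesAt M (inj₂ j) i = hasEdge M i j

  whiskersAt : (WEdge H → Bool) → (v : HV H) → WhiskerCode.Whisker (nbrs v) → Bool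
  whiskersAt M (inj₁ i) k = M (wedge (inj₁ i) k)
  whiskersAt M (inj₂ j) k = M (wedge (inj₂ j) k)

  IsLocallyMatching : (WEdge H → Bool) → Set
  IsLocallyMatching M = ∀ v → IsLocalMatching (nbrs v) (edgesAt M v) (whiskersAt M v)

  module _ {M : WEdge H → Bool} where

    hasEdge-intro : ∀ {i j e} → T (M (hedge i j e)) → T (hasEdge M i j)
    hasEdge-intro {e = e} m = subst T (sym (whenT-≡ _ e)) m

    hasEdge-elim : ∀ {i j} → T (hasEdge M i j) → ∃ λ e → T (M (hedge i j e))
    hasEdge-elim h = let e = whenT-T _ h in e , subst T (whenT-≡ _ e) h

  hedge-≡ : ∀ {i i′ j j′} {e : T (adj i j)} {e′ : T (adj i′ j′)} → i ≡ i′ → j ≡ j′ →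
            hedge i j e ≡ hedge i′ j′ e′
  hedge-≡ refl refl = cong (hedge _ _) (T-irrelevant _ _)

  data EdgeAt : HV H → WEdge H → Set where
    edgeˢ   : ∀ {i j} (e : T (adj i j)) → EdgeAt (inj₁ i) (hedge i j e)
    edgeᵗ   : ∀ {i j} (e : T (adj i j)) → EdgeAt (inj₂ j) (hedge i j e)
    whisker : ∀ {v} k → EdgeAt v (wedge v k)

  edgeAt : ∀ {v ε} → Incident (W H) (orig v) ε → EdgeAt v ε
  edgeAt {ε = hedge i j e} (inj₁ refl) = edgeˢ e
  edgeAt {ε = hedge i j e} (inj₂ refl) = edgeᵗ e
  edgeAt {ε = wedge v k}   (inj₁ refl) = whisker k

  incident-pend : ∀ {v k ε} → Incident (W H) (pend v k) ε → ε ≡ wedge v k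
  incident-pend {ε = hedge i j e} (inj₁ ())
  incident-pend {ε = hedge i j e} (inj₂ ())
  incident-pend {ε = wedge v k}   (inj₁ ())
  incident-pend {ε = wedge v k}   (inj₂ refl) = refl

  module _ {M : WEdge H → Bool} where

    atMostOneAt : ∀ {v ε ε′} → IsLocalMatching (nbrs v) (edgesAt M v) (whiskersAt M v) →
                  EdgeAt v ε → EdgeAt v ε′ → T (M ε) → T (M ε′) → ε ≡ ε′
    atMostOneAt L (edgeˢ _) (edgeˢ _) m m′ =
      hedge-≡ refl (edge-unique L (hasEdge-intro {M} m) (hasEdge-intro {M} m′))
    atMostOneAt L (edgeᵗ _) (edgeᵗ _) m m′ =
      hedge-≡ (edge-unique L (hasEdge-intro {M} m) (hasEdge-intro {M} m′)) refl
    atMostOneAt L (edgeˢ _) (whisker _) m m′ = ⊥-elim (edge-whisker L (hasEdge-intro {M} m) m′)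
    atMostOneAt L (edgeᵗ _) (whisker _) m m′ = ⊥-elim (edge-whisker L (hasEdge-intro {M} m) m′)
    atMostOneAt L (whisker _) (edgeˢ _) m m′ = ⊥-elim (edge-whisker L (hasEdge-intro {M} m′) m)
    atMostOneAt L (whisker _) (edgeᵗ _) m m′ = ⊥-elim (edge-whisker L (hasEdge-intro {M} m′) m)
    atMostOneAt {inj₁ _} L (whisker _) (whisker _) m m′ = cong (wedge _) (whisker-unique L m m′)
    atMostOneAt {inj₂ _} L (whisker _) (whisker _) m m′ = cong (wedge _) (whisker-unique L m m′)

    local⇒isMatching : IsLocallyMatching M → IsMatching (W H) M
    local⇒isMatching loc ε ε′ m m′ (orig v)   x x′ = atMostOneAt (loc v) (edgeAt x) (edgeAt x′) m m′
    local⇒isMatching loc ε ε′ m m′ (pend v k) x x′ = trans (incident-pend x) (sym (incident-pend x′))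

    isMatching⇒local : IsMatching (W H) M → IsLocallyMatching M
    isMatching⇒local mat (inj₁ i) = record
      { edge⇒nbr       = whenT-T _
      ; edge-unique    = λ h h′ → hedge-injectiveʳ (mat _ _ (inM h) (inM h′) _ (inj₁ refl) (inj₁ refl))
      ; whisker-unique = λ w w′ → wedge-injective (mat _ _ w w′ _ (inj₁ refl) (inj₁ refl))
      ; edge-whisker   = λ h w → hedge≢wedge (mat _ _ (inM h) w _ (inj₁ refl) (inj₁ refl))
      }
      where
      inM : ∀ {j} (h : T (hasEdge M i j)) → T (M (hedge i j (proj₁ (hasEdge-elim {M} h))))
      inM h = proj₂ (hasEdge-elim {M} h)
      hedge-injectiveʳ : ∀ {j j′} {e : T (adj i j)} {e′ : T (adj i j′)} → hedge i j e ≡ hedge i j′ e′ → j ≡ j′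
      hedge-injectiveʳ refl = refl
      wedge-injective : ∀ {k l} → wedge (inj₁ i) k ≡ wedge (inj₁ i) l → k ≡ l
      wedge-injective refl = refl
      hedge≢wedge : ∀ {j k} {e : T (adj i j)} → hedge i j e ≢ wedge (inj₁ i) k
      hedge≢wedge ()
    isMatching⇒local mat (inj₂ j) = record
      { edge⇒nbr       = whenT-T _
      ; edge-unique    = λ h h′ → hedge-injectiveˡ (mat _ _ (inM h) (inM h′) _ (inj₂ refl) (inj₂ refl))
      ; whisker-unique = λ w w′ → wedge-injective (mat _ _ w w′ _ (inj₁ refl) (inj₁ refl))
      ; edge-whisker   = λ h w → hedge≢wedge (mat _ _ (inM h) w _ (inj₂ refl) (inj₁ refl))
      }
      where
      inM : ∀ {i} (h : T (hasEdge M i j)) → T (M (hedge i j (proj₁ (hasEdge-elim {M} h))))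
      inM h = proj₂ (hasEdge-elim {M} h)
      hedge-injectiveˡ : ∀ {i i′} {e : T (adj i j)} {e′ : T (adj i′ j)} → hedge i j e ≡ hedge i′ j e′ → i ≡ i′
      hedge-injectiveˡ refl = refl
      wedge-injective : ∀ {k l} → wedge (inj₂ j) k ≡ wedge (inj₂ j) l → k ≡ l
      wedge-injective refl = refl
      hedge≢wedge : ∀ {i k} {e : T (adj i j)} → hedge i j e ≢ wedge (inj₂ j) k
      hedge≢wedge ()

  joinedAt-cong : ∀ {d d′} → d ≈ᵖ d′ → ∀ v x → joinedAt d v x ≡ joinedAt d′ v x
  joinedAt-cong (_ , eq) (inj₁ i) j = eq i j
  joinedAt-cong (_ , eq) (inj₂ j) i = eq i j

  toMatching : PivotSystem → WEdge H → Bool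
  toMatching d (hedge i j _)      = joined d i j
  toMatching d (wedge (inj₁ i) k) = encodeWhiskers (nbrs (inj₁ i)) (pivot d (inj₁ i)) (joinedAt d (inj₁ i)) k
  toMatching d (wedge (inj₂ j) k) = encodeWhiskers (nbrs (inj₂ j)) (pivot d (inj₂ j)) (joinedAt d (inj₂ j)) k

  module _ (d : PivotSystem) where

    edgesAt-toMatching : ∀ v x → edgesAt (toMatching d) v x ≡ joinedAt d v x
    edgesAt-toMatching v@(inj₁ i) j =
      whenT-const _ (λ _ → refl) (IsSelection.sel⇒nbr (pivot-isSelection d v) ∘ joinedAt⇒pivot d v)
    edgesAt-toMatching v@(inj₂ j) i =
      whenT-const _ (λ _ → refl) (IsSelection.sel⇒nbr (pivot-isSelection d v) ∘ joinedAt⇒pivot d v)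

    whiskersAt-toMatching : ∀ v k →
                            whiskersAt (toMatching d) v k ≡ encodeWhiskers (nbrs v) (pivot d v) (joinedAt d v) k
    whiskersAt-toMatching (inj₁ i) k = refl
    whiskersAt-toMatching (inj₂ j) k = refl

    toMatching-isLocallyMatching : IsLocallyMatching (toMatching d)
    toMatching-isLocallyMatching v =
      WhiskerCode.IsLocalMatching-resp (nbrs v) (sym ∘ edgesAt-toMatching v) (sym ∘ whiskersAt-toMatching v)
        (WhiskerCode.encodeWhiskers-isLocalMatching (nbrs v) (pivot-isSelection d v) (joinedAt⇒pivot d v))

  fromMatching : (M : WEdge H → Bool) → IsLocallyMatching M → PivotSystem
  fromMatching M loc = record
    { pivot             = λ v → decodePivot (nbrs v) (edgesAt M v) (whiskersAt M v)
    ; joined            = hasEdge M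
    ; pivot-isSelection = λ v → WhiskerCode.decodePivot-isSelection (nbrs v) (loc v)
    ; joined⇒pivotˢ     = WhiskerCode.edge⇒decodePivot (nbrs (inj₁ _)) (loc (inj₁ _))
    ; joined⇒pivotᵗ     = WhiskerCode.edge⇒decodePivot (nbrs (inj₂ _)) (loc (inj₂ _))
    }

  toMatching-fromMatching : ∀ M loc ε → toMatching (fromMatching M loc) ε ≡ M ε
  toMatching-fromMatching M loc (hedge i j e)      = whenT-≡ _ e
  toMatching-fromMatching M loc (wedge (inj₁ i) k) = WhiskerCode.encode-decode (nbrs (inj₁ i)) (loc (inj₁ i)) k
  toMatching-fromMatching M loc (wedge (inj₂ j) k) = WhiskerCode.encode-decode (nbrs (inj₂ j)) (loc (inj₂ j)) k

  fromMatching-toMatching : ∀ d loc → fromMatching (toMatching d) loc ≈ᵖ d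
  fromMatching-toMatching d loc = pivots , edgesAt-toMatching d ∘ inj₁
    where
    pivots : ∀ v x → _
    pivots v x = trans (WhiskerCode.decodePivot-cong (nbrs v) (edgesAt-toMatching d v) (whiskersAt-toMatching d v) x)
                       (WhiskerCode.decode-encode (nbrs v) (pivot-isSelection d v) (joinedAt⇒pivot d v) x)

  toMatching-cong : ∀ {d d′} → d ≈ᵖ d′ → ∀ ε → toMatching d ε ≡ toMatching d′ ε
  toMatching-cong (_ , eq) (hedge i j _) = eq i j
  toMatching-cong {d} {d′} d≈d′ (wedge (inj₁ i) k) =
    WhiskerCode.encodeWhiskers-cong (nbrs (inj₁ i)) (proj₁ d≈d′ (inj₁ i))
      (joinedAt-cong {d} {d′} d≈d′ (inj₁ i)) k
  toMatching-cong {d} {d′} d≈d′ (wedge (inj₂ j) k) =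
    WhiskerCode.encodeWhiskers-cong (nbrs (inj₂ j)) (proj₁ d≈d′ (inj₂ j))
      (joinedAt-cong {d} {d′} d≈d′ (inj₂ j)) k

  module _ {M M′ : WEdge H → Bool} (eq : ∀ ε → M ε ≡ M′ ε) where

    edgesAt-cong : ∀ v x → edgesAt M v x ≡ edgesAt M′ v x
    edgesAt-cong (inj₁ i) j = whenT-cong λ e → eq (hedge i j e)
    edgesAt-cong (inj₂ j) i = whenT-cong λ e → eq (hedge i j e)

    whiskersAt-cong : ∀ v k → whiskersAt M v k ≡ whiskersAt M′ v k
    whiskersAt-cong (inj₁ i) k = eq (wedge (inj₁ i) k)
    whiskersAt-cong (inj₂ j) k = eq (wedge (inj₂ j) k)

    fromMatching-cong : ∀ loc loc′ → fromMatching M loc ≈ᵖ fromMatching M′ loc′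
    fromMatching-cong _ _ =
      (λ v → WhiskerCode.decodePivot-cong (nbrs v) (edgesAt-cong v) (whiskersAt-cong v)) , edgesAt-cong ∘ inj₁

  pivotSystems↔matchings : Inverse PivotSystems (Matchings (W H))
  pivotSystems↔matchings = inverseFromStrict
    (λ d → toMatching d , local⇒isMatching (toMatching-isLocallyMatching d))
    (λ (M , mat) → fromMatching M (isMatching⇒local mat))
    toMatching-cong
    (λ {(_ , mat)} {(_ , mat′)} eq → fromMatching-cong eq (isMatching⇒local mat) (isMatching⇒local mat′))
    (λ (M , mat) → toMatching-fromMatching M (isMatching⇒local mat))
    (λ d → fromMatching-toMatching d (isMatching⇒local (local⇒isMatching (toMatching-isLocallyMatching d))))

-- Pivots of maximal cliques

_ᵀ : BipGraph → BipGraph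
H ᵀ = record { n = BipGraph.m H ; m = BipGraph.n H ; adj = λ j i → BipGraph.adj H i j }

module _ {H : BipGraph} where

  flipRoute : Route (H ᵀ) → Route H
  flipRoute (route a j i b e) = route b i j a e

  flipRoutes : RouteSet H → RouteSet (H ᵀ)
  flipRoutes C = C ∘ flipRoute

  flip-incoherentForm : ∀ {r r′} → IncoherentForm (H ᵀ) r r′ → IncoherentForm H (flipRoute r′) (flipRoute r)
  flip-incoherentForm (form1 e e′)    = form1 e′ e
  flip-incoherentForm (form2 e e′ lt) = form3 e′ e lt
  flip-incoherentForm (form3 e e′ lt) = form2 e′ e lt

  flip-isClique : ∀ {C} → IsClique H C → IsClique (H ᵀ) (flipRoutes C)
  flip-isClique clique r r′ c c′ (inj₁ f) = clique _ _ c c′ (inj₂ (flip-incoherentForm f))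
  flip-isClique clique r r′ c c′ (inj₂ f) = clique _ _ c c′ (inj₁ (flip-incoherentForm f))

flip-isMaximalClique : ∀ {H C} → IsMaximalClique H C → IsMaximalClique (H ᵀ) (flipRoutes C)
flip-isMaximalClique (clique , maximal) =
  flip-isClique clique , λ D D-clique C⊆D r d →
    maximal (flipRoutes D) (flip-isClique D-clique) (λ r → C⊆D (flipRoute r)) (flipRoute r) d

module CliquePivots (H : BipGraph) where
  open BipGraph H

  member : RouteSet H → Fin 2 → Fin n → Fin m → Fin 2 → Bool
  member C a i j b = whenT (λ e → C (route a i j b e))

  uses : RouteSet H → Fin 2 → Fin n → Fin m → Bool
  uses C a i j = anyᵇ (member C a i j)

  pivotˢ : RouteSet H → Fin n → Fin m → Bool
  pivotˢ C i j = uses C one i j ∧ uses C two i j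

  _≟ʳ_ : (r r′ : Route H) → Dec (r ≡ r′)
  route a i j b e ≟ʳ route a′ i′ j′ b′ e′ with a ≟ a′ | i ≟ i′ | j ≟ j′ | b ≟ b′
  ... | yes refl | yes refl | yes refl | yes refl = yes (cong (route a i j b) (T-irrelevant e e′))
  ... | no a≢a′  | _        | _        | _        = no λ { refl → a≢a′ refl }
  ... | yes _    | no i≢i′  | _        | _        = no λ { refl → i≢i′ refl }
  ... | yes _    | yes _    | no j≢j′  | _        = no λ { refl → j≢j′ refl }
  ... | yes _    | yes _    | yes _    | no b≢b′  = no λ { refl → b≢b′ refl }

  pivotˢ-cong : ∀ {C D} → (∀ r → C r ≡ D r) → ∀ i j → pivotˢ C i j ≡ pivotˢ D i j
  pivotˢ-cong {C} {D} eq i j = cong₂ _∧_ (anyᵇ-cong (member-cong one)) (anyᵇ-cong (member-cong two))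
    where
    member-cong : ∀ a b → member C a i j b ≡ member D a i j b
    member-cong a b = whenT-cong λ e → eq (route a i j b e)

  module Members (C : RouteSet H) where

    route-irrelevant : ∀ {a i j b e e′} → T (C (route a i j b e)) → T (C (route a i j b e′))
    route-irrelevant c = subst (λ e → T (C (route _ _ _ _ e))) (T-irrelevant _ _) c

    member-intro : ∀ {a i j b e} → T (C (route a i j b e)) → T (member C a i j b)
    member-intro {e = e} c = subst T (sym (whenT-≡ _ e)) c

    member-elim : ∀ a i j b → T (member C a i j b) → ∃ λ e → T (C (route a i j b e))
    member-elim a i j b h = let e = whenT-T _ h in e , subst T (whenT-≡ _ e) h

    uses-intro : ∀ {a i j b e} → T (C (route a i j b e)) → T (uses C a i j)
    uses-intro {b = b} c = any-intro b (member-intro c)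

    uses-elim : ∀ a i j → T (uses C a i j) → ∃ λ b → ∃ λ e → T (C (route a i j b e))
    uses-elim a i j h = let (b , m) = any-elim h in b , member-elim a i j b m

    pivotˢ-elim : ∀ i j → T (pivotˢ C i j) → T (uses C one i j) × T (uses C two i j)
    pivotˢ-elim i j = ∧⁻ {uses C one i j}

  module _ {C : RouteSet H} (clique : IsClique H C) where
    open Members C

    conflict : ∀ {r r′} → IncoherentForm H r r′ → T (C r) → ¬ T (C r′)
    conflict f c c′ = clique _ _ c c′ (inj₁ f)

    uses-ordered : ∀ {i j k} → T (uses C one i k) → T (uses C two i j) → ¬ j < k
    uses-ordered {i} {j} {k} u₁ u₂ j<k =
      let (_ , _ , c) = uses-elim one i k u₁ ; (_ , _ , c′) = uses-elim two i j u₂ in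
      conflict (form2 _ _ j<k) c c′

    pivotˢ-unique : ∀ i → AtMostOne (pivotˢ C i)
    pivotˢ-unique i {j} {j′} p p′ with <-cmp j j′
    ... | tri≈ _ j≡j′ _ = j≡j′
    ... | tri< j<j′ _ _ =
      ⊥-elim (uses-ordered (proj₁ (pivotˢ-elim i j′ p′)) (proj₂ (pivotˢ-elim i j p)) j<j′)
    ... | tri> _ _ j′<j =
      ⊥-elim (uses-ordered (proj₁ (pivotˢ-elim i j p)) (proj₂ (pivotˢ-elim i j′ p′)) j′<j)

    route⇒side : ∀ {a i j b e} → T (C (route a i j b e)) → T (side a (pivotˢ C i) j)
    route⇒side {one} {i} c = fromWitnessFalse λ (y , y<j , p) →
      uses-ordered (uses-intro c) (proj₂ (pivotˢ-elim i y p)) y<j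
    route⇒side {two} {i} c = fromWitnessFalse λ (y , j<y , p) →
      uses-ordered (proj₁ (pivotˢ-elim i y p)) (uses-intro c) j<y

  module _ {C : RouteSet H} (maximal : IsMaximalClique H C) where
    open Members C
    private
      clique = proj₁ maximal

    absorb : ∀ r → (∀ r′ → T (C r′) → ¬ IncoherentForm H r r′) →
             (∀ r′ → T (C r′) → ¬ IncoherentForm H r′ r) → T (C r)
    absorb r before after =
      proj₂ maximal C∪r C∪r-isClique (λ _ → ∨⁺ ∘ inj₁) r (∨⁺ {C r} (inj₂ (fromWitness {a? = r ≟ʳ r} refl)))
      where
      C∪r : RouteSet H
      C∪r r′ = C r′ ∨ isYes (r′ ≟ʳ r)
      C∪r-elim : ∀ {r′} → T (C∪r r′) → T (C r′) ⊎ r′ ≡ r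
      C∪r-elim {r′} h = [ inj₁ , inj₂ ∘ toWitness ] (∨⁻ {C r′} h)
      C∪r-isClique : IsClique H C∪r
      C∪r-isClique r₁ r₂ h₁ h₂ with C∪r-elim h₁ | C∪r-elim h₂
      ... | inj₁ c₁   | inj₁ c₂   = clique r₁ r₂ c₁ c₂
      ... | inj₁ c₁   | inj₂ refl = [ after r₁ c₁ , before r₁ c₁ ]
      ... | inj₂ refl | inj₁ c₂   = [ before r₂ c₂ , after r₂ c₂ ]
      ... | inj₂ refl | inj₂ refl = [ (λ ()) , (λ ()) ]

    module _ {i k} (e : T (adj i k)) where

      least-α₂⇒α₁γ₁ : T (C (route two i k one e)) → (∀ {y} → y < k → ¬ T (uses C two i y)) →
                      T (C (route one i k one e))
      least-α₂⇒α₁γ₁ c₂₁ below = absorb _ before after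
        where
        before : ∀ r′ → T (C r′) → ¬ IncoherentForm H (route one i k one e) r′
        before _ c′ (form2 _ _ y<k) = below y<k (uses-intro c′)
        after : ∀ r′ → T (C r′) → ¬ IncoherentForm H r′ (route one i k one e)
        after _ c′ (form3 _ _ i′<i) = conflict clique (form3 _ _ i′<i) c′ c₂₁

      least-α₂⇒α₁γ₂ : T (C (route two i k two e)) → ¬ T (C (route two i k one e)) →
                      (∀ {y} → y < k → ¬ T (uses C two i y)) → T (C (route one i k two e))
      least-α₂⇒α₁γ₂ c₂₂ ¬c₂₁ below = absorb _ before λ _ _ ()
        where
        before : ∀ r′ → T (C r′) → ¬ IncoherentForm H (route one i k two e) r′
        before _ c′ (form1 _ _)      = ¬c₂₁ (route-irrelevant c′)
        before _ c′ (form2 _ _ y<k)  = below y<k (uses-intro c′)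
        before _ c′ (form3 _ _ i<i′) = conflict clique (form3 _ _ i<i′) c₂₂ c′

      greatest-α₁⇒α₂γ₂ : T (C (route one i k two e)) → (∀ {y} → k < y → ¬ T (uses C one i y)) →
                         T (C (route two i k two e))
      greatest-α₁⇒α₂γ₂ c₁₂ above = absorb _ before after
        where
        before : ∀ r′ → T (C r′) → ¬ IncoherentForm H (route two i k two e) r′
        before _ c′ (form3 _ _ i<i′) = conflict clique (form3 _ _ i<i′) c₁₂ c′
        after : ∀ r′ → T (C r′) → ¬ IncoherentForm H r′ (route two i k two e)
        after _ c′ (form2 _ _ k<y) = above k<y (uses-intro c′)

      greatest-α₁⇒α₂γ₁ : T (C (route one i k one e)) → ¬ T (C (route one i k two e)) →
                         (∀ {y} → k < y → ¬ T (uses C one i y)) → T (C (route two i k one e))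
      greatest-α₁⇒α₂γ₁ c₁₁ ¬c₁₂ above = absorb _ (λ _ _ ()) after
        where
        after : ∀ r′ → T (C r′) → ¬ IncoherentForm H r′ (route two i k one e)
        after _ c′ (form1 _ _)      = ¬c₁₂ (route-irrelevant c′)
        after _ c′ (form2 _ _ k<y)  = above k<y (uses-intro c′)
        after _ c′ (form3 _ _ i′<i) = conflict clique (form3 _ _ i′<i) c′ c₁₁

    pivot-at-least : ∀ {i k} → T (uses C two i k) → (∀ {y} → y < k → ¬ T (uses C two i y)) →
                     T (pivotˢ C i k)
    pivot-at-least {i} {k} u₂ below with uses-elim two i k u₂
    ... | one , e , c₂₁ = ∧⁺ (uses-intro (least-α₂⇒α₁γ₁ e c₂₁ below)) u₂
    ... | two , e , c₂₂ with T? (C (route two i k one e))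
    ...   | yes c₂₁ = ∧⁺ (uses-intro (least-α₂⇒α₁γ₁ e c₂₁ below)) u₂
    ...   | no ¬c₂₁ = ∧⁺ (uses-intro (least-α₂⇒α₁γ₂ e c₂₂ ¬c₂₁ below)) u₂

    pivot-at-greatest : ∀ {i k} → T (uses C one i k) → (∀ {y} → k < y → ¬ T (uses C one i y)) →
                        T (pivotˢ C i k)
    pivot-at-greatest {i} {k} u₁ above with uses-elim one i k u₁
    ... | two , e , c₁₂ = ∧⁺ u₁ (uses-intro (greatest-α₁⇒α₂γ₂ e c₁₂ above))
    ... | one , e , c₁₁ with T? (C (route one i k two e))
    ...   | yes c₁₂ = ∧⁺ u₁ (uses-intro (greatest-α₁⇒α₂γ₂ e c₁₂ above))
    ...   | no ¬c₁₂ = ∧⁺ u₁ (uses-intro (greatest-α₁⇒α₂γ₁ e c₁₁ ¬c₁₂ above))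

    no-α₂⇒α₁ : ∀ {i j₀} → T (adj i j₀) → (∀ {j} → ¬ T (uses C two i j)) →
               ∃ λ j → T (uses C one i j)
    no-α₂⇒α₁ {i} {j₀} e₀ no-α₂ with any? (λ i′ → i′ <? i ×-dec T? (anyᵇ λ a → member C a i′ j₀ two))
    ... | yes (i′ , i′<i , γ₂) = j₀ , uses-intro (absorb (route one i j₀ two e₀) before λ _ _ ())
      where
      earlier : ∃ λ a → ∃ λ e → T (C (route a i′ j₀ two e))
      earlier = let (a , m) = any-elim γ₂ in a , member-elim a i′ j₀ two m
      before : ∀ r′ → T (C r′) → ¬ IncoherentForm H (route one i j₀ two e₀) r′
      before _ c′ (form1 _ _)      = no-α₂ (uses-intro c′)
      before _ c′ (form2 _ _ _)    = no-α₂ (uses-intro c′)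
      before _ c′ (form3 _ _ i<i″) =
        conflict clique (form3 _ _ (<-trans i′<i i<i″)) (proj₂ (proj₂ earlier)) c′
    ... | no ¬γ₂ = j₀ , uses-intro (absorb (route one i j₀ one e₀) before after)
      where
      before : ∀ r′ → T (C r′) → ¬ IncoherentForm H (route one i j₀ one e₀) r′
      before _ c′ (form2 _ _ _) = no-α₂ (uses-intro c′)
      after : ∀ r′ → T (C r′) → ¬ IncoherentForm H r′ (route one i j₀ one e₀)
      after _ c′ (form3 _ _ i″<i) = ¬γ₂ (_ , i″<i , any-intro _ (member-intro c′))

    pivotˢ-exists : ∀ {i j₀} → T (adj i j₀) → ∃ λ k → T (pivotˢ C i k)
    pivotˢ-exists {i} e₀ with T? (anyᵇ (uses C two i))
    ... | yes α₂ = let (k , u₂ , below) = least (uses C two i) (proj₂ (any-elim α₂)) in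
                   k , pivot-at-least u₂ below
    ... | no ¬α₂ = let (_ , u₁) = no-α₂⇒α₁ e₀ λ u₂ → ¬α₂ (any-intro _ u₂)
                       (k , u₁ , above) = greatest (uses C one i) u₁ in
                   k , pivot-at-greatest u₁ above

    pivotˢ-isSelection : ∀ i → IsSelection (adj i) (pivotˢ C i)
    pivotˢ-isSelection i = record
      { sel⇒nbr  = λ {j} p → proj₁ (proj₂ (uses-elim one i j (proj₁ (pivotˢ-elim i j p))))
      ; unique   = pivotˢ-unique clique i
      ; nonempty = pivotˢ-exists
      }

-- Maximal cliques and pivot systems

module _ (H : BipGraph) where
  open BipGraph H
  open CliquePivots H
  private
    module ᵀ = CliquePivots (H ᵀ)

  -- Transposing H turns γ-indices at j ∈ T into α-indices at j ∈ S.
  pivotᵗ : RouteSet H → Fin n → Fin m → Bool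
  pivotᵗ C i j = ᵀ.pivotˢ (flipRoutes C) j i

  joinedIn : RouteSet H → Fin n → Fin m → Bool
  joinedIn C i j = pivotˢ C i j ∧ pivotᵗ C i j ∧ member C one i j two

  pivotsOf : RouteSet H → (v : HV H) → Fin (arity H v) → Bool
  pivotsOf C (inj₁ i)   = pivotˢ C i
  pivotsOf C (inj₂ j) i = pivotᵗ C i j

  systemOf : (C : RouteSet H) → IsMaximalClique H C → PivotSystem H
  systemOf C maximal = record
    { pivot             = pivotsOf C
    ; joined            = joinedIn C
    ; pivot-isSelection = λ { (inj₁ i) → pivotˢ-isSelection maximal i
                            ; (inj₂ j) → ᵀ.pivotˢ-isSelection (flip-isMaximalClique maximal) j }
    ; joined⇒pivotˢ     = λ {i} {j} h → proj₁ (∧⁻ {pivotˢ C i j} h)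
    ; joined⇒pivotᵗ     = λ {i} {j} h → proj₁ (∧⁻ {pivotᵗ C i j} (proj₂ (∧⁻ {pivotˢ C i j} h)))
    }

  systemOf-cong : ∀ {C D mC mD} → (∀ r → C r ≡ D r) → _≈ᵖ_ H (systemOf C mC) (systemOf D mD)
  systemOf-cong {C} {D} eq = pivots , λ i j →
      cong₂ _∧_ (pivotˢ-cong eq i j)
                (cong₂ _∧_ (ᵀ.pivotˢ-cong (eq ∘ flipRoute) j i) (whenT-cong λ e → eq (route one i j two e)))
    where
    pivots : ∀ v x → pivotsOf C v x ≡ pivotsOf D v x
    pivots (inj₁ i) j = pivotˢ-cong eq i j
    pivots (inj₂ j) i = ᵀ.pivotˢ-cong (eq ∘ flipRoute) j i

  module PivotClique (d : PivotSystem H) where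
    open PivotSystem d

    sidesˢ sidesᵗ : Fin n → Fin m → Fin 2 → Bool
    sidesˢ i j a = side a (pivot (inj₁ i)) j
    sidesᵗ i j b = side b (pivot (inj₂ j)) i

    cliqueOf : RouteSet H
    cliqueOf (route a i j b _) = cell (sidesˢ i j) (sidesᵗ i j) (joined i j) a b

    private
      module atˢ (i : Fin n) = IsSelection (pivot-isSelection (inj₁ i))
      module atᵗ (j : Fin m) = IsSelection (pivot-isSelection (inj₂ j))

    pivot-routeˢ : ∀ {i p} → T (pivot (inj₁ i) p) → ∀ e a → ∃ λ b → T (cliqueOf (route a i p b e))
    pivot-routeˢ {i} {p} pp e a =
      let (_ , pq) = atᵗ.nonempty p e in
      cell-row {sidesˢ i p} {sidesᵗ i p} {joined i p} a (selected⇒side (atˢ.unique i) pp a)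
        (atOrBelow-or-atOrAbove (atᵗ.unique p) pq i)

    pivot-routeᵗ : ∀ {q j} → T (pivot (inj₂ j) q) → ∀ e b → ∃ λ a → T (cliqueOf (route a q j b e))
    pivot-routeᵗ {q} {j} pq e b =
      let (_ , pp) = atˢ.nonempty q e in
      cell-col {sidesˢ q j} {sidesᵗ q j} {joined q j} b (selected⇒side (atᵗ.unique j) pq b)
        (atOrBelow-or-atOrAbove (atˢ.unique q) pp j)

    cliqueOf-coherent : ∀ {r r′} → IncoherentForm H r r′ → T (cliqueOf r) → ¬ T (cliqueOf r′)
    cliqueOf-coherent (form1 {i} {j} _ _) c c′ = cell-cross {sidesˢ i j} {sidesᵗ i j} {joined i j} c c′
    cliqueOf-coherent (form2 {i} {j} {k} {b} {b′} e _ j<k) c c′ =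
      let (_ , pp) = atˢ.nonempty i e in
      atOrAbove-atOrBelow (atˢ.unique i) pp (proj₁ (cell⇒sides two b′ c′)) (proj₁ (cell⇒sides one b c)) j<k
    cliqueOf-coherent (form3 {a} {a′} {i} {i′} {j} e _ i<i′) c c′ =
      let (_ , pq) = atᵗ.nonempty j e in
      atOrAbove-atOrBelow (atᵗ.unique j) pq (proj₂ (cell⇒sides a two c)) (proj₂ (cell⇒sides a′ one c′)) i<i′

    cliqueOf-isClique : IsClique H cliqueOf
    cliqueOf-isClique _ _ c c′ (inj₁ f) = cliqueOf-coherent f c c′
    cliqueOf-isClique _ _ c c′ (inj₂ f) = cliqueOf-coherent f c′ c

    outside⇒incoherent : ∀ r → ¬ T (cliqueOf r) → ∃ λ r′ → T (cliqueOf r′) × Incoherent H r r′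
    outside⇒incoherent (route a i j b e) ¬c with T? (sidesˢ i j a) | T? (sidesᵗ i j b)
    outside⇒incoherent (route one i j b e) ¬c | no ¬A | _ =
      let (y , y<j , py) = ¬atOrBelow ¬A ; e′ = atˢ.sel⇒nbr i py ; (b′ , c′) = pivot-routeˢ py e′ two in
      route two i y b′ e′ , c′ , inj₁ (form2 e e′ y<j)
    outside⇒incoherent (route two i j b e) ¬c | no ¬A | _ =
      let (y , j<y , py) = ¬atOrAbove ¬A ; e′ = atˢ.sel⇒nbr i py ; (b′ , c′) = pivot-routeˢ py e′ one in
      route one i y b′ e′ , c′ , inj₂ (form2 e′ e j<y)
    outside⇒incoherent (route a i j one e) ¬c | yes _ | no ¬B =
      let (y , y<i , py) = ¬atOrBelow ¬B ; e′ = atᵗ.sel⇒nbr j py ; (a′ , c′) = pivot-routeᵗ py e′ two in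
      route a′ y j two e′ , c′ , inj₂ (form3 e′ e y<i)
    outside⇒incoherent (route a i j two e) ¬c | yes _ | no ¬B =
      let (y , i<y , py) = ¬atOrAbove ¬B ; e′ = atᵗ.sel⇒nbr j py ; (a′ , c′) = pivot-routeᵗ py e′ one in
      route a′ y j one e′ , c′ , inj₁ (form3 e e′ i<y)
    outside⇒incoherent (route one i j one e) ¬c | yes A | yes B =
      ⊥-elim (¬c (cell-diag {sidesˢ i j} {sidesᵗ i j} {joined i j} one A B))
    outside⇒incoherent (route two i j two e) ¬c | yes A | yes B =
      ⊥-elim (¬c (cell-diag {sidesˢ i j} {sidesᵗ i j} {joined i j} two A B))
    outside⇒incoherent (route one i j two e) ¬c | yes A | yes B =
      route two i j one e , cell-complete {sidesˢ i j} {sidesᵗ i j} {joined i j} one two A B ¬c ,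
      inj₁ (form1 e e)
    outside⇒incoherent (route two i j one e) ¬c | yes A | yes B =
      route one i j two e , cell-complete {sidesˢ i j} {sidesᵗ i j} {joined i j} two one A B ¬c ,
      inj₂ (form1 e e)

    cliqueOf-isMaximalClique : IsMaximalClique H cliqueOf
    cliqueOf-isMaximalClique = cliqueOf-isClique , maximal
      where
      maximal : ∀ D → IsClique H D → _⊆R_ H cliqueOf D → _⊆R_ H D cliqueOf
      maximal D D-clique ⊆D r d with T? (cliqueOf r)
      ... | yes c = c
      ... | no ¬c = let (r′ , c′ , incoherent) = outside⇒incoherent r ¬c in
                    ⊥-elim (D-clique r r′ d (⊆D r′ c′) incoherent)

    private
      module Cᵀ = ᵀ.Members (flipRoutes cliqueOf)
    open Members cliqueOf

    pivotˢ-cliqueOf : ∀ i j → pivotˢ cliqueOf i j ≡ pivot (inj₁ i) j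
    pivotˢ-cliqueOf i j = T-ext to from
      where
      to : T (pivotˢ cliqueOf i j) → T (pivot (inj₁ i) j)
      to h = let (u₁ , u₂) = pivotˢ-elim i j h ; (b , e , c) = uses-elim one i j u₁
                 (b′ , _ , c′) = uses-elim two i j u₂ ; (_ , pp) = atˢ.nonempty i e in
             sides⇒selected (atˢ.unique i) pp (proj₁ (cell⇒sides one b c)) (proj₁ (cell⇒sides two b′ c′))
      from : T (pivot (inj₁ i) j) → T (pivotˢ cliqueOf i j)
      from pj = let e = atˢ.sel⇒nbr i pj ; (b , c) = pivot-routeˢ pj e one ; (b′ , c′) = pivot-routeˢ pj e two in
                ∧⁺ (uses-intro {one} {i} {j} {b} {e} c) (uses-intro {two} {i} {j} {b′} {e} c′)

    pivotᵗ-cliqueOf : ∀ i j → pivotᵗ cliqueOf i j ≡ pivot (inj₂ j) i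
    pivotᵗ-cliqueOf i j = T-ext to from
      where
      to : T (pivotᵗ cliqueOf i j) → T (pivot (inj₂ j) i)
      to h = let (u₁ , u₂) = Cᵀ.pivotˢ-elim j i h ; (a , e , c) = Cᵀ.uses-elim one j i u₁
                 (a′ , _ , c′) = Cᵀ.uses-elim two j i u₂ ; (_ , pq) = atᵗ.nonempty j e in
             sides⇒selected (atᵗ.unique j) pq (proj₂ (cell⇒sides a one c)) (proj₂ (cell⇒sides a′ two c′))
      from : T (pivot (inj₂ j) i) → T (pivotᵗ cliqueOf i j)
      from pi = let e = atᵗ.sel⇒nbr j pi ; (a , c) = pivot-routeᵗ pi e one ; (a′ , c′) = pivot-routeᵗ pi e two in
                ∧⁺ (Cᵀ.uses-intro {one} {j} {i} {a} {e} c) (Cᵀ.uses-intro {two} {j} {i} {a′} {e} c′)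

    joinedIn-cliqueOf : ∀ i j → joinedIn cliqueOf i j ≡ joined i j
    joinedIn-cliqueOf i j = T-ext to from
      where
      to : T (joinedIn cliqueOf i j) → T (joined i j)
      to h = let (ps , rest) = ∧⁻ {pivotˢ cliqueOf i j} h ; (pt , m₁₂) = ∧⁻ {pivotᵗ cliqueOf i j} rest
                 (_ , c₁₂) = member-elim one i j two m₁₂
                 ps′ = subst T (pivotˢ-cliqueOf i j) ps ; pt′ = subst T (pivotᵗ-cliqueOf i j) pt in
             cell₁₂⇒J {sidesˢ i j} {sidesᵗ i j} {joined i j}
               (selected⇒side (atˢ.unique i) ps′ two) (selected⇒side (atᵗ.unique j) pt′ one) c₁₂
      from : T (joined i j) → T (joinedIn cliqueOf i j)
      from J = let ps′ = joined⇒pivotˢ J ; pt′ = joined⇒pivotᵗ J ; e = atˢ.sel⇒nbr i ps′ in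
               ∧⁺ (subst T (sym (pivotˢ-cliqueOf i j)) ps′)
                  (∧⁺ (subst T (sym (pivotᵗ-cliqueOf i j)) pt′)
                      (member-intro {one} {i} {j} {two} {e} (cell₁₂-intro {sidesˢ i j} {sidesᵗ i j} {joined i j}
                        (selected⇒side (atˢ.unique i) ps′ one) (selected⇒side (atᵗ.unique j) pt′ two) λ _ _ → J)))

    systemOf-cliqueOf : _≈ᵖ_ H (systemOf cliqueOf cliqueOf-isMaximalClique) d
    systemOf-cliqueOf = pivots , joinedIn-cliqueOf
      where
      pivots : ∀ v x → pivotsOf cliqueOf v x ≡ pivot v x
      pivots (inj₁ i) j = pivotˢ-cliqueOf i j
      pivots (inj₂ j) i = pivotᵗ-cliqueOf i j

  open PivotClique using (sidesˢ; sidesᵗ; cliqueOf; cliqueOf-isClique; cliqueOf-isMaximalClique; systemOf-cliqueOf)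

  cliqueOf-cong : ∀ {d d′} → _≈ᵖ_ H d d′ → ∀ r → cliqueOf d r ≡ cliqueOf d′ r
  cliqueOf-cong (eqP , eqJ) (route a i j b _) =
    cell-cong (λ a → side-cong (eqP (inj₁ i)) a j) (λ b → side-cong (eqP (inj₂ j)) b i) (eqJ i j) a b

  module _ {C : RouteSet H} (maximal : IsMaximalClique H C) where
    open Members C
    private
      clique = proj₁ maximal
      d = systemOf C maximal
      module atˢ (i : Fin n) = IsSelection (pivotˢ-isSelection maximal i)
      module atᵗ (j : Fin m) = IsSelection (ᵀ.pivotˢ-isSelection (flip-isMaximalClique maximal) j)

    route⇒sideˢ : ∀ {a i j b e} → T (C (route a i j b e)) → T (sidesˢ d i j a)
    route⇒sideˢ = route⇒side clique

    route⇒sideᵗ : ∀ {a i j b e} → T (C (route a i j b e)) → T (sidesᵗ d i j b)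
    route⇒sideᵗ {a} {i} {j} {b} {e} = ᵀ.route⇒side (flip-isClique clique) {b} {j} {i} {a} {e}

    joinedIn-intro : ∀ {i j e} → T (C (route one i j two e)) → T (sidesˢ d i j two) → T (sidesᵗ d i j one) →
                     T (joinedIn C i j)
    joinedIn-intro {i} {j} {e} c₁₂ α₂ γ₁ =
      let (_ , p) = atˢ.nonempty i e ; (_ , q) = atᵗ.nonempty j e in
      ∧⁺ (sides⇒selected (atˢ.unique i) p (route⇒sideˢ c₁₂) α₂)
         (∧⁺ (sides⇒selected (atᵗ.unique j) q γ₁ (route⇒sideᵗ c₁₂)) (member-intro c₁₂))

    joinedIn⇒route₁₂ : ∀ i j → T (joinedIn C i j) → ∃ λ e → T (C (route one i j two e))
    joinedIn⇒route₁₂ i j J =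
      member-elim one i j two (proj₂ (∧⁻ {pivotᵗ C i j} (proj₂ (∧⁻ {pivotˢ C i j} J))))

    ⊆cliqueOf-systemOf : _⊆R_ H C (cliqueOf d)
    ⊆cliqueOf-systemOf (route one i j one e) c =
      cell-diag {sidesˢ d i j} {sidesᵗ d i j} {joinedIn C i j} one (route⇒sideˢ c) (route⇒sideᵗ c)
    ⊆cliqueOf-systemOf (route two i j two e) c =
      cell-diag {sidesˢ d i j} {sidesᵗ d i j} {joinedIn C i j} two (route⇒sideˢ c) (route⇒sideᵗ c)
    ⊆cliqueOf-systemOf (route one i j two e) c =
      cell₁₂-intro {sidesˢ d i j} {sidesᵗ d i j} {joinedIn C i j} (route⇒sideˢ c) (route⇒sideᵗ c)
        (joinedIn-intro c)
    ⊆cliqueOf-systemOf (route two i j one e) c =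
      cell₂₁-intro {sidesˢ d i j} {sidesᵗ d i j} {joinedIn C i j} (route⇒sideˢ c) (route⇒sideᵗ c)
        λ _ _ J → let (_ , c₁₂) = joinedIn⇒route₁₂ i j J in conflict clique (form1 _ _) c₁₂ c

    cliqueOf-systemOf : ∀ r → cliqueOf d r ≡ C r
    cliqueOf-systemOf r =
      T-ext (proj₂ maximal (cliqueOf d) (cliqueOf-isClique d) ⊆cliqueOf-systemOf r) (⊆cliqueOf-systemOf r)

  maxCliques↔pivotSystems : Inverse (MaxCliques H) (PivotSystems H)
  maxCliques↔pivotSystems = inverseFromStrict
    (λ (C , maximal) → systemOf C maximal)
    (λ d → cliqueOf d , cliqueOf-isMaximalClique d)
    (λ {(_ , mC)} {(_ , mD)} → systemOf-cong {mC = mC} {mD = mD})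
    (λ {d} {d′} → cliqueOf-cong {d} {d′})
    systemOf-cliqueOf
    (λ (C , maximal) → cliqueOf-systemOf maximal)

corollary3p10 : (H : BipGraph) → NoDeg01 H → Bijection (MaxCliques H) (Matchings (W H))
corollary3p10 H _ = Inverse⇒Bijection (Compose.inverse (maxCliques↔pivotSystems H) (pivotSystems↔matchings H))
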